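{- Let $g \geq 3$ be an integer and let $\mathcal{S}_{4,g}$ be the set of numerical semigroups with multiplicity $4$ and genus $g$. If $g=3$ then $\#\mathcal{S}_{4,g}=1$; otherwise $\#\mathcal{S}_{4,g} = -g + \frac{5}{2} \lfloor \frac{g}{4} \rfloor +\lfloor \frac{g}{2} \rfloor+\frac{1}{2}\lfloor \frac{g+5}{6} \rfloor+\lfloor \frac{g+5}{6} \rfloor g -\lfloor \frac{g+5}{6} \rfloor\lfloor \frac{g}{2} \rfloor-\frac{3}{2}\lfloor \frac{g+5}{6} \rfloor^2-\lfloor \frac{g}{4} \rfloor g+\frac{3}{2} \lfloor \frac{g}{4} \rfloor^2+\lfloor \frac{g}{4} \rfloor\lfloor \frac{g}{2} \rfloor-\frac{1}{2}\lfloor \frac{g+2}{6} \rfloor+\lfloor \frac{g+2}{6} \rfloor\lfloor \frac{g}{2} \rfloor-\frac{3}{2}\lfloor \frac{g+2}{6} \rfloor^2+\frac{1}{2} \lfloor \frac{g+2}{4} \rfloor+\frac{3}{2} \lfloor \frac{g+2}{4} \rfloor^2-\lfloor \frac{g+2}{4} \rfloor\lfloor \frac{g}{2} \rfloor+\lfloor \frac{g+1}{2} \rfloor\lfloor \frac{g}{2} \rfloor-\lfloor \frac{g+1}{2} \rfloor\lceil \frac{2g-3}{8} \rceil+\lfloor \frac{g+1}{2} \rfloor-\lceil \frac{2g-7}{8} \rceil \lfloor \frac{g}{2} \rfloor+\lceil \frac{2g-7}{8} \rceil\lceil \frac{2g-3}{8} \rceil-\lceil \frac{2g-7}{8} \r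ceil$.
   Context: A numerical semigroup is a subset $S \subseteq \mathbb{N}$ containing $0$, closed under addition, with $\mathbb{N}\setminus S$ finite. Its multiplicity is $\min(S\setminus\{0\})$ and its genus is $\#(\mathbb{N}\setminus S)$. -}

module Defs where

open import Data.Nat using (ℕ; _<_)
import Data.Nat as N
open import Data.Integer as Int using (ℤ; +_)
open import Relation.Binary.PropositionalEquality using (_≡_)
open import Data.List using (List; length)
open import Data.List.Membership.Propositional using (_∈_; _∉_)
open import Data.List.Relation.Unary.All using (All)
open import Data.List.Relation.Unary.Unique.Propositional using (Unique)
open import Data.List.Relation.Unary.Linked using (Linked)
open import Data.Product using (Σ; ∃-syntax; _×_)
open import Relation.Nullary using (¬_)

record IsNumericalSemigroup (S : ℕ → Set) : Set where
  field
    zero∈ : S 0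
    closed : ∀ a b → S a → S b → S (a N.+ b)
    cofinite : ∃[ L ] (∀ n → ¬ S n → n ∈ L)

record HasMultiplicity (S : ℕ → Set) (m : ℕ) : Set where
  field
    nonzero : 0 < m
    member : S m
    least : ∀ k → 0 < k → k < m → ¬ S k

semigroupWithGaps : List ℕ → ℕ → Set
semigroupWithGaps G n = n ∉ G

-- Numerical semigroups are represented canonically by their gap set
-- ℕ ∖ S, written as a strictly increasing list G.  Since G lists the gaps
-- exactly once each, the genus is length G.
InS4g : ℕ → List ℕ → Set
InS4g g G =
  Linked _<_ G ×
  IsNumericalSemigroup (semigroupWithGaps G) ×
  HasMultiplicity (semigroupWithGaps G) 4 ×
  length G ≡ g

HasCardinality : (List ℕ → Set) → ℕ → Set
HasCardinality P N =
  ∃[ L ] (Unique L × All P L × (∀ G → P G → G ∈ L) × length L ≡ N)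

ceil8 : ℕ → ℕ
ceil8 a = (a N.+ 7) N./ 8

-- Twice the right-hand side of the formula (so that it is an integer).
twiceFormula : ℕ → ℤ
twiceFormula g =
  - G2 + + 5 * A + + 2 * B + C + + 2 * C * G - + 2 * C * B - + 3 * C * C
  - + 2 * A * G + + 3 * A * A + + 2 * A * B
  - D + + 2 * D * B - + 3 * D * D
  + E + + 3 * E * E - + 2 * E * B
  + + 2 * F * B - + 2 * F * P + + 2 * F
  - + 2 * Q * B + + 2 * Q * P - + 2 * Q
  where
  open Int using (_+_; _*_; _-_; -_)
  G  = + g
  G2 = + (2 N.* g)
  A  = + (g N./ 4)
  B  = + (g N./ 2)
  C  = + ((g N.+ 5) N./ 6)
  D  = + ((g N.+ 2) N./ 6)
  E  = + ((g N.+ 2) N./ 4)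
  F  = + ((g N.+ 1) N./ 2)
  P  = + ceil8 ((2 N.* g) N.∸ 3)
  Q  = + ceil8 ((2 N.* g) N.∸ 7)

-- A numerical semigroup of multiplicity 4 is determined by its Kunz coordinates (a, b, k):
-- its gaps are 4q + 1 for q < a, 4q + 2 for q < b and 4q + 3 for q < k, so its genus is
-- a + b + k, and it is closed under addition iff a, b, k ≥ 1, b ≤ 2a, k ≤ a + b,
-- a ≤ b + k + 1 and b ≤ 2k + 1.  For fixed genus g and fixed b these inequalities cut out
-- an interval of values of a, of length b + 1 when 3b ≤ g and g + 1 − 2b otherwise.
-- Summing over b, the number S(g) of semigroups satisfies S(g + 3) = S(g) + 2 + ⌈g/2⌉,
-- hence S(g + 12) = S(g) + 2g + 18.  For g ≥ 4 the two ceilings in the formula equal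
-- ⌊(g + 2)/4⌋ and ⌊g/4⌋, and then the formula obeys the same recurrence by a polynomial
-- identity in its floor terms, so it remains to compare both sides for 4 ≤ g ≤ 15.
module Submission where

open import Relation.Binary.PropositionalEquality
import Data.Integer.Base as ℤ

module TwiceFormula where
  open ℤ using (ℤ; +_; _+_; _*_; _-_; -_)
  open import Data.Integer.Tactic.RingSolver using (solve-∀)

  -- Inlined so that the ring solver sees the polynomial; the opaque copy `formula` keeps
  -- unification from unfolding it, so the implicit arguments of formula-cong are inferable.
  polynomial : (G G₂ A B C D E F P Q : ℤ) → ℤ
  polynomial G G₂ A B C D E F P Q =
    - G₂ + + 5 * A + + 2 * B + C + + 2 * C * G - + 2 * C * B - + 3 * C * C
    - + 2 * A * G + + 3 * A * A + + 2 * A * B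
    - D + + 2 * D * B - + 3 * D * D
    + E + + 3 * E * E - + 2 * E * B
    + + 2 * F * B - + 2 * F * P + + 2 * F
    - + 2 * Q * B + + 2 * Q * P - + 2 * Q
  {-# INLINE polynomial #-}

  opaque
    formula : (G G₂ A B C D E F P Q : ℤ) → ℤ
    formula = polynomial

  formula-cong : ∀ {G G′ G₂ G₂′ A A′ B B′ C C′ D D′ E E′ F F′ P P′ Q Q′} →
    G ≡ G′ → G₂ ≡ G₂′ → A ≡ A′ → B ≡ B′ → C ≡ C′ →
    D ≡ D′ → E ≡ E′ → F ≡ F′ → P ≡ P′ → Q ≡ Q′ →
    formula G G₂ A B C D E F P Q ≡ formula G′ G₂′ A′ B′ C′ D′ E′ F′ P′ Q′
  formula-cong refl refl refl refl refl refl refl refl refl refl = refl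

  -- The step g ↦ 12 + g, with the relations G = B + F, P = E and Q = A (valid for g ≥ 4) built in.
  opaque
    unfolding formula
    formula-shift : ∀ G₂ A B C D E F →
      formula (B + + 6 + (F + + 6)) (G₂ + + 24) (A + + 3) (B + + 6) (C + + 2)
              (D + + 2) (E + + 3) (F + + 6) (E + + 3) (A + + 3)
      ≡ formula (B + F) G₂ A B C D E F E A + (+ 4 * (B + F) + + 36)
    formula-shift = polynomial-shift
      where
      polynomial-shift : ∀ G₂ A B C D E F →
        polynomial (B + + 6 + (F + + 6)) (G₂ + + 24) (A + + 3) (B + + 6) (C + + 2)
                   (D + + 2) (E + + 3) (F + + 6) (E + + 3) (A + + 3)
        ≡ polynomial (B + F) G₂ A B C D E F E A + (+ 4 * (B + F) + + 36)
      polynomial-shift = solve-∀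

-- The arithmetic of ℕ is opened only here: its operators would clash with those of ℤ above.
open import Data.Bool.Base using (true; false; if_then_else_)
open import Data.Empty using (⊥-elim)
open import Data.Integer.Properties using (pos-+; pos-*)
open import Data.List.Base using (List; []; _∷_; map; filter; length; applyUpTo; upTo; cartesianProduct)
open import Data.List.Properties using (filter-++; length-++; length-map)
open import Data.List.Membership.Propositional using (_∈_; _∉_)
open import Data.List.Membership.Propositional.Properties
  using (∈-filter⁺; ∈-filter⁻; ∈-upTo⁺; ∈-map⁺; ∈-map⁻; ∈-cartesianProduct⁺)
open import Data.List.Relation.Unary.Any using (here; there)
import Data.List.Relation.Unary.All as All
open import Data.List.Relation.Unary.AllPairs using (AllPairs; []; _∷_)
open import Data.List.Relation.Unary.Linked using (Linked)
import Data.List.Relation.Unary.Linked.Properties as Linked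
import Data.List.Relation.Unary.Unique.Propositional.Properties as Unique
open import Data.Nat.Base
open import Data.Nat.Properties
open import Data.Nat.DivMod
open import Data.Nat.Divisibility using (n∣m*n; ∣-refl)
open import Data.Nat.ListAction using (sum)
open import Data.Nat.Tactic.RingSolver using (solve-∀)
open import Data.List.Membership.DecPropositional _≟_ using (_∈?_)
open import Data.Product.Base using (∃-syntax; _×_; _,_; proj₂)
open import Function.Base using (id; _∘_)
open import Function.Bundles using (_⇔_; mk⇔; module Equivalence)
open import Function.Construct.Composition using (_⇔-∘_)
open import Function.Construct.Symmetry using (⇔-sym)
open import Relation.Nullary.Decidable
  using (Dec; does; yes; no; _×-dec_; does-⇔; dec-true; dec-false; decidable-stable; map′)
open import Relation.Nullary.Negation using (¬_)
open import Relation.Unary using (Decidable)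
open import Defs

open Equivalence using (to; from)

sumBelow : ℕ → (ℕ → ℕ) → ℕ
sumBelow zero    f = 0
sumBelow (suc n) f = f 0 + sumBelow n (f ∘ suc)

sumBelow-cong : ∀ n {f h : ℕ → ℕ} → (∀ {i} → i < n → f i ≡ h i) → sumBelow n f ≡ sumBelow n h
sumBelow-cong zero    f≡h = refl
sumBelow-cong (suc n) f≡h = cong₂ _+_ (f≡h z<s) (sumBelow-cong n (f≡h ∘ s<s))

sumBelow-suc : ∀ n (f : ℕ → ℕ) → sumBelow (suc n) f ≡ sumBelow n f + f n
sumBelow-suc zero    f = +-identityʳ (f 0)
sumBelow-suc (suc n) f =
  trans (cong (f 0 +_) (sumBelow-suc n (f ∘ suc))) (sym (+-assoc (f 0) _ _))

sumBelow-+ : ∀ n (f h : ℕ → ℕ) → sumBelow n (λ i → f i + h i) ≡ sumBelow n f + sumBelow n h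
sumBelow-+ zero    f h = refl
sumBelow-+ (suc n) f h =
  trans (cong (f 0 + h 0 +_) (sumBelow-+ n (f ∘ suc) (h ∘ suc))) (+-interchange (f 0) _ _ _)
  where
  +-interchange : ∀ a b c d → a + b + (c + d) ≡ a + c + (b + d)
  +-interchange = solve-∀

≤-sumBelow : ∀ n (f : ℕ → ℕ) {i} → i < n → f i ≤ sumBelow n f
≤-sumBelow (suc n) f {zero}  _         = m≤m+n (f 0) _
≤-sumBelow (suc n) f {suc i} (s<s i<n) = ≤-trans (≤-sumBelow n (f ∘ suc) i<n) (m≤n+m _ (f 0))

sumBelow-0 : ∀ n → sumBelow n (λ _ → 0) ≡ 0
sumBelow-0 zero    = refl
sumBelow-0 (suc n) = sumBelow-0 n

sumBelow-split : ∀ m n (f : ℕ → ℕ) → sumBelow (m + n) f ≡ sumBelow m f + sumBelow n (f ∘ (m +_))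
sumBelow-split zero    n f = refl
sumBelow-split (suc m) n f = trans (cong (f 0 +_) (sumBelow-split m n (f ∘ suc))) (sym (+-assoc (f 0) _ _))

indicator : {A : Set} → Dec A → ℕ
indicator a? = if does a? then 1 else 0

indicator-yes : ∀ {A : Set} (a? : Dec A) → A → indicator a? ≡ 1
indicator-yes a? a = cong (λ b → if b then 1 else 0) (dec-true a? a)

indicator-no : ∀ {A : Set} (a? : Dec A) → ¬ A → indicator a? ≡ 0
indicator-no a? ¬a = cong (λ b → if b then 1 else 0) (dec-false a? ¬a)

count : {P : ℕ → Set} → Decidable P → ℕ → ℕ
count P? n = sumBelow n (indicator ∘ P?)

length-filter-applyUpTo : ∀ {A : Set} {P : A → Set} (P? : Decidable P) (f : ℕ → A) n →
  length (filter P? (applyUpTo f n)) ≡ sumBelow n (indicator ∘ P? ∘ f)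
length-filter-applyUpTo P? f zero = refl
length-filter-applyUpTo P? f (suc n) with does (P? (f 0))
... | true  = cong suc (length-filter-applyUpTo P? (f ∘ suc) n)
... | false = length-filter-applyUpTo P? (f ∘ suc) n

length-filter-map : ∀ {A B : Set} {P : B → Set} (P? : Decidable P) (f : A → B) xs →
  length (filter P? (map f xs)) ≡ length (filter (P? ∘ f) xs)
length-filter-map P? f []       = refl
length-filter-map P? f (x ∷ xs) with does (P? (f x))
... | true  = cong suc (length-filter-map P? f xs)
... | false = length-filter-map P? f xs

length-filter-cartesianProduct : ∀ {A B : Set} {P : A × B → Set} (P? : Decidable P) (f : ℕ → A) n (ys : List B) →
  length (filter P? (cartesianProduct (applyUpTo f n) ys))
    ≡ sumBelow n (λ i → length (filter (P? ∘ (f i ,_)) ys))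
length-filter-cartesianProduct P? f zero    ys = refl
length-filter-cartesianProduct P? f (suc n) ys = begin
  length (filter P? (map (f 0 ,_) ys List.++ cartesianProduct (applyUpTo (f ∘ suc) n) ys))
    ≡⟨ cong length (filter-++ P? (map (f 0 ,_) ys) _) ⟩
  length (filter P? (map (f 0 ,_) ys) List.++ filter P? (cartesianProduct (applyUpTo (f ∘ suc) n) ys))
    ≡⟨ length-++ (filter P? (map (f 0 ,_) ys)) ⟩
  length (filter P? (map (f 0 ,_) ys)) + length (filter P? (cartesianProduct (applyUpTo (f ∘ suc) n) ys))
    ≡⟨ cong₂ _+_ (length-filter-map P? (f 0 ,_) ys) (length-filter-cartesianProduct P? (f ∘ suc) n ys) ⟩
  sumBelow (suc n) (λ i → length (filter (P? ∘ (f i ,_)) ys)) ∎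
  where
  open ≡-Reasoning
  import Data.List.Base as List

count-cong : ∀ {P Q : ℕ → Set} (P? : Decidable P) (Q? : Decidable Q) n →
  (∀ {i} → i < n → P i ⇔ Q i) → count P? n ≡ count Q? n
count-cong P? Q? n P⇔Q =
  sumBelow-cong n λ i<n → cong (λ b → if b then 1 else 0) (does-⇔ (P⇔Q i<n) (P? _) (Q? _))

count-none : ∀ {P : ℕ → Set} (P? : Decidable P) n → (∀ i → ¬ P i) → count P? n ≡ 0
count-none P? zero    ¬P = refl
count-none P? (suc n) ¬P =
  cong₂ _+_ (indicator-no (P? 0) (¬P 0)) (count-none (P? ∘ suc) n (¬P ∘ suc))

count-interval : ∀ lo hi n → count (λ a → lo ≤? a ×-dec a <? hi) n ≡ n ⊓ hi ∸ lo
count-interval lo hi zero    = sym (0∸n≡0 lo)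
count-interval lo hi (suc n) = begin
  count (λ a → lo ≤? a ×-dec a <? hi) (suc n)
    ≡⟨ sumBelow-suc n _ ⟩
  count (λ a → lo ≤? a ×-dec a <? hi) n + indicator (lo ≤? n ×-dec n <? hi)
    ≡⟨ cong (_+ indicator (lo ≤? n ×-dec n <? hi)) (count-interval lo hi n) ⟩
  n ⊓ hi ∸ lo + indicator (lo ≤? n ×-dec n <? hi)
    ≡⟨ step (lo ≤? n) (n <? hi) ⟩
  suc n ⊓ hi ∸ lo ∎
  where
  open ≡-Reasoning
  ceiling : ¬ n < hi → n ⊓ hi ≡ suc n ⊓ hi
  ceiling n≮hi = trans (m≥n⇒m⊓n≡n hi≤n) (sym (m≥n⇒m⊓n≡n (m≤n⇒m≤1+n hi≤n)))
    where hi≤n = ≮⇒≥ n≮hi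
  step : (lo≤n? : Dec (lo ≤ n)) (n<hi? : Dec (n < hi)) →
    n ⊓ hi ∸ lo + indicator (lo≤n? ×-dec n<hi?) ≡ suc n ⊓ hi ∸ lo
  step (yes lo≤n) (yes n<hi) rewrite m≤n⇒m⊓n≡m (<⇒≤ n<hi) | m≤n⇒m⊓n≡m n<hi =
    trans (+-comm (n ∸ lo) 1) (sym (+-∸-assoc 1 lo≤n))
  step (no lo≰n) (yes n<hi) rewrite m≤n⇒m⊓n≡m (<⇒≤ n<hi) | m≤n⇒m⊓n≡m n<hi =
    trans (+-identityʳ (n ∸ lo)) (trans (m≤n⇒m∸n≡0 (<⇒≤ n<lo)) (sym (m≤n⇒m∸n≡0 n<lo)))
    where n<lo = ≰⇒> lo≰n
  step (yes _) (no n≮hi) = trans (+-identityʳ _) (cong (_∸ lo) (ceiling n≮hi))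
  step (no _)  (no n≮hi) = trans (+-identityʳ _) (cong (_∸ lo) (ceiling n≮hi))

⌈n/2⌉≤1+⌊n/2⌋ : ∀ n → ⌈ n /2⌉ ≤ suc ⌊ n /2⌋
⌈n/2⌉≤1+⌊n/2⌋ zero          = z≤n
⌈n/2⌉≤1+⌊n/2⌋ (suc zero)    = s≤s z≤n
⌈n/2⌉≤1+⌊n/2⌋ (suc (suc n)) = s≤s (⌈n/2⌉≤1+⌊n/2⌋ n)

≤⌊n/2⌋⇔ : ∀ a n → a ≤ ⌊ n /2⌋ ⇔ a + a ≤ n
≤⌊n/2⌋⇔ a n = mk⇔
  (λ a≤ → ≤-trans (+-mono-≤ a≤ (≤-trans a≤ (⌊n/2⌋≤⌈n/2⌉ n)))
                  (≤-reflexive (⌊n/2⌋+⌈n/2⌉≡n n)))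
  (λ a+a≤n → subst (_≤ ⌊ n /2⌋) (sym (n≡⌊n+n/2⌋ a)) (⌊n/2⌋-mono a+a≤n))

⌈n/2⌉≤⇔ : ∀ n a → ⌈ n /2⌉ ≤ a ⇔ n ≤ a + a
⌈n/2⌉≤⇔ n a = mk⇔
  (λ ≤a → ≤-trans (≤-reflexive (sym (⌊n/2⌋+⌈n/2⌉≡n n)))
                  (+-mono-≤ (≤-trans (⌊n/2⌋≤⌈n/2⌉ n) ≤a) ≤a))
  (λ n≤a+a → subst (⌈ n /2⌉ ≤_) (sym (n≡⌈n+n/2⌉ a)) (⌈n/2⌉-mono n≤a+a))

⌊n/2⌋≤⇔ : ∀ n k → ⌊ n /2⌋ ≤ k ⇔ n ≤ suc (k + k)
⌊n/2⌋≤⇔ n k = mk⇔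
  (λ ≤k → begin
    n                       ≡⟨ ⌊n/2⌋+⌈n/2⌉≡n n ⟨
    ⌊ n /2⌋ + ⌈ n /2⌉       ≤⟨ +-mono-≤ ≤k (≤-trans (⌈n/2⌉≤1+⌊n/2⌋ n) (s≤s ≤k)) ⟩
    k + suc k               ≡⟨ +-suc k k ⟩
    suc (k + k)             ∎)
  (λ n≤ → subst (⌊ n /2⌋ ≤_) (sym (n≡⌈n+n/2⌉ k)) (⌊n/2⌋-mono n≤))
  where open ≤-Reasoning

⌈[m*2+n]/2⌉≡m+⌈n/2⌉ : ∀ m n → ⌈ m * 2 + n /2⌉ ≡ m + ⌈ n /2⌉
⌈[m*2+n]/2⌉≡m+⌈n/2⌉ zero    n = refl
⌈[m*2+n]/2⌉≡m+⌈n/2⌉ (suc m) n = cong suc (⌈[m*2+n]/2⌉≡m+⌈n/2⌉ m n)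

sorted-≡ : ∀ {xs ys : List ℕ} → AllPairs _<_ xs → AllPairs _<_ ys →
  (∀ {z} → z ∈ xs ⇔ z ∈ ys) → xs ≡ ys
sorted-≡ {[]}     {[]}     _ _ _ = refl
sorted-≡ {[]}     {y ∷ ys} _ _ xs⇔ys with () ← from xs⇔ys (here refl)
sorted-≡ {x ∷ xs} {[]}     _ _ xs⇔ys with () ← to xs⇔ys (here refl)
sorted-≡ {x ∷ xs} {y ∷ ys} (x< ∷ xs<) (y< ∷ ys<) xs⇔ys
  with heads-≡ (to xs⇔ys (here refl)) (from xs⇔ys (here refl))
  where
  heads-≡ : x ∈ y ∷ ys → y ∈ x ∷ xs → x ≡ y
  heads-≡ (here x≡y)  _           = x≡y
  heads-≡ (there _)   (here y≡x)  = sym y≡x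
  heads-≡ (there x∈)  (there y∈)  = ⊥-elim (<-asym (All.lookup y< x∈) (All.lookup x< y∈))
... | refl = cong (x ∷_) (sorted-≡ xs< ys< (mk⇔
  (λ z∈ → drop-head (All.lookup x< z∈) (to xs⇔ys (there z∈)))
  (λ z∈ → drop-head (All.lookup y< z∈) (from xs⇔ys (there z∈)))))
  where
  drop-head : ∀ {z zs} → x < z → z ∈ x ∷ zs → z ∈ zs
  drop-head x<z (here refl) = ⊥-elim (<-irrefl refl x<z)
  drop-head x<z (there z∈)  = z∈

Linked-<-≡ : ∀ {xs ys : List ℕ} → Linked _<_ xs → Linked _<_ ys →
  (∀ {z} → z ∈ xs ⇔ z ∈ ys) → xs ≡ ys
Linked-<-≡ xs↗ ys↗ = sorted-≡ (Linked.Linked⇒AllPairs <-trans xs↗) (Linked.Linked⇒AllPairs <-trans ys↗)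

∈⇒≤sum : ∀ {x xs} → x ∈ xs → x ≤ sum xs
∈⇒≤sum {xs = x ∷ xs} (here refl) = m≤m+n x (sum xs)
∈⇒≤sum {xs = y ∷ xs} (there x∈) = ≤-trans (∈⇒≤sum x∈) (m≤n+m (sum xs) y)

-- The least n < B with ¬ P n, or B if there is none.
leastFailure : {P : ℕ → Set} → Decidable P → ℕ → ℕ
leastFailure P? zero    = 0
leastFailure P? (suc B) = if does (P? 0) then suc (leastFailure (P? ∘ suc) B) else 0

leastFailure-below : ∀ {P : ℕ → Set} (P? : Decidable P) B {n} → n < leastFailure P? B → P n
leastFailure-below P? (suc B) {n} n< with P? 0
leastFailure-below P? (suc B) {zero}  _         | yes p = p
leastFailure-below P? (suc B) {suc n} (s<s n<) | yes _ = leastFailure-below (P? ∘ suc) B n<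

leastFailure-fails : ∀ {P : ℕ → Set} (P? : Decidable P) B → ¬ P B → ¬ P (leastFailure P? B)
leastFailure-fails P? zero    ¬PB = ¬PB
leastFailure-fails P? (suc B) ¬PB with P? 0
... | yes _  = leastFailure-fails (P? ∘ suc) B ¬PB
... | no ¬P0 = ¬P0

≡⇒⇔ : ∀ {A B : Set} → A ≡ B → A ⇔ B
≡⇒⇔ refl = mk⇔ id id

[m+kn]/n≡m/n+k : ∀ m k n .{{_ : NonZero n}} → (m + k * n) / n ≡ m / n + k
[m+kn]/n≡m/n+k m k n = trans (+-distrib-/-∣ʳ m (n∣m*n k)) (cong (m / n +_) (m*n/n≡m k n))

0<m∸n⇒n<m : ∀ {m n} → 0 < m ∸ n → n < m
0<m∸n⇒n<m 0<m∸n = m∸n≢0⇒n<m λ m∸n≡0 → <-irrefl (sym m∸n≡0) 0<m∸n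

1+-<⇔<-pred : ∀ q x → suc q < x ⇔ q < pred x
1+-<⇔<-pred q zero    = mk⇔ (λ ()) (λ ())
1+-<⇔<-pred q (suc x) = mk⇔ s<s⁻¹ s<s

-- Kunz coordinates of a numerical semigroup

module KunzCoordinates (m : ℕ) .{{_ : NonZero m}} where

  0<m : 0 < m
  0<m = >-nonZero⁻¹ m

  -- w i is the number of gaps congruent to i modulo m: they are i, i + m, …, i + (w i − 1) m.
  IsGap : (ℕ → ℕ) → ℕ → Set
  IsGap w n = n / m < w (n % m)

  isGap? : ∀ w → Decidable (IsGap w)
  isGap? w n = n / m <? w (n % m)

  isGap-at : ∀ w {i} q → i < m → IsGap w (i + q * m) ⇔ q < w i
  isGap-at w {i} q i<m = ≡⇒⇔ (cong₂ _<_
    (trans ([m+kn]/n≡m/n+k i q m) (cong (_+ q) (m<n⇒m/n≡0 i<m)))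
    (cong w (trans ([m+kn]%n≡m%n i q m) (m<n⇒m%n≡m i<m))))

  isGap-below : ∀ w {i} → i < m → IsGap w i ⇔ 0 < w i
  isGap-below w i<m = ≡⇒⇔ (cong₂ _<_ (m<n⇒m/n≡0 i<m) (cong w (m<n⇒m%n≡m i<m)))

  isGap-shift : ∀ w n → IsGap w (m + n) ⇔ IsGap (pred ∘ w) n
  isGap-shift w n = 1+-<⇔<-pred (n / m) (w (n % m)) ⇔-∘ ≡⇒⇔ (cong₂ _<_
    (trans (+-distrib-/-∣ˡ n ∣-refl) (cong (_+ n / m) (n/n≡1 m)))
    (cong w (%-remove-+ˡ n ∣-refl)))

  record KunzInequalities (w : ℕ → ℕ) : Set where
    field
      w0≡0        : w 0 ≡ 0
      subadditive : ∀ {i j} → i < m → j < m → w ((i + j) % m) ≤ (i + j) / m + w i + w j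

  /-distrib-+ : ∀ x y → (x + y) / m ≡ (x % m + y % m) / m + x / m + y / m
  /-distrib-+ x y = begin
    (x + y) / m
      ≡⟨ cong (_/ m) (trans (cong₂ _+_ (m≡m%n+[m/n]*n x m) (m≡m%n+[m/n]*n y m))
                            (regroup (x % m) (x / m) (y % m) (y / m) m)) ⟩
    (x % m + y % m + (x / m + y / m) * m) / m
      ≡⟨ [m+kn]/n≡m/n+k (x % m + y % m) (x / m + y / m) m ⟩
    (x % m + y % m) / m + (x / m + y / m)
      ≡⟨ +-assoc ((x % m + y % m) / m) (x / m) (y / m) ⟨
    (x % m + y % m) / m + x / m + y / m ∎
    where
    open ≡-Reasoning
    regroup : ∀ a b c d e → a + b * e + (c + d * e) ≡ a + c + (b + d) * e
    regroup = solve-∀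

  nonGap-+ : ∀ {w} → KunzInequalities w → ∀ {x y} → ¬ IsGap w x → ¬ IsGap w y → ¬ IsGap w (x + y)
  nonGap-+ {w} K {x} {y} x∉ y∉ = ≤⇒≯ (begin
    w ((x + y) % m)                                ≡⟨ cong w (%-distribˡ-+ x y m) ⟩
    w ((x % m + y % m) % m)                        ≤⟨ subadditive (m%n<n x m) (m%n<n y m) ⟩
    (x % m + y % m) / m + w (x % m) + w (y % m)    ≤⟨ +-mono-≤ (+-monoʳ-≤ _ (≮⇒≥ x∉)) (≮⇒≥ y∉) ⟩
    (x % m + y % m) / m + x / m + y / m            ≡⟨ /-distrib-+ x y ⟨
    (x + y) / m                                    ∎)
    where
    open ≤-Reasoning
    open KunzInequalities K

  gapList : (ℕ → ℕ) → List ℕ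
  gapList w = filter (isGap? w) (upTo (sumBelow m w * m))

  gap<bound : ∀ w {n} → IsGap w n → n < sumBelow m w * m
  gap<bound w {n} gap = begin-strict
    n                     ≡⟨ m≡m%n+[m/n]*n n m ⟩
    n % m + n / m * m     <⟨ +-monoˡ-< (n / m * m) (m%n<n n m) ⟩
    suc (n / m) * m       ≤⟨ *-monoˡ-≤ m (≤-trans gap (≤-sumBelow m w (m%n<n n m))) ⟩
    sumBelow m w * m      ∎
    where open ≤-Reasoning

  ∈-gapList : ∀ w {n} → n ∈ gapList w ⇔ IsGap w n
  ∈-gapList w = mk⇔ (proj₂ ∘ ∈-filter⁻ (isGap? w) {xs = upTo (sumBelow m w * m)})
    (λ gap → ∈-filter⁺ (isGap? w) {xs = upTo (sumBelow m w * m)} (∈-upTo⁺ (gap<bound w gap)) gap)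

  gapList-sorted : ∀ w → Linked _<_ (gapList w)
  gapList-sorted w = Linked.filter⁺ (isGap? w) <-trans (Linked.applyUpTo⁺₂ id (sumBelow m w * m) n<1+n)

  gapList-≡ : ∀ {w w′} → (∀ {n} → IsGap w n ⇔ IsGap w′ n) → gapList w ≡ gapList w′
  gapList-≡ {w} {w′} w⇔w′ = Linked-<-≡ (gapList-sorted w) (gapList-sorted w′)
    (⇔-sym (∈-gapList w′) ⇔-∘ (w⇔w′ ⇔-∘ ∈-gapList w))

  gapList-cong : ∀ {w w′} → (∀ {i} → i < m → w i ≡ w′ i) → gapList w ≡ gapList w′
  gapList-cong w≡w′ = gapList-≡ λ {n} → ≡⇒⇔ (cong (n / m <_) (w≡w′ (m%n<n n m)))

  gapList-injective : ∀ w w′ → gapList w ≡ gapList w′ → ∀ {i} → i < m → w i ≤ w′ i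
  gapList-injective w w′ eq {i} i<m = ≮⇒≥ λ w′i<wi → <-irrefl refl
    (to (isGap-at w′ (w′ i) i<m) (to (∈-gapList w′)
      (subst (_ ∈_) eq (from (∈-gapList w) (from (isGap-at w (w′ i) i<m) w′i<wi)))))

  count-gaps : ∀ w N → count (isGap? w) (N * m) ≡ sumBelow m (λ i → w i ⊓ N)
  count-gaps w zero    = sym (trans (sumBelow-cong m (λ {i} _ → ⊓-zeroʳ (w i))) (sumBelow-0 m))
  count-gaps w (suc N) = begin
    count (isGap? w) (m + N * m)
      ≡⟨ sumBelow-split m (N * m) _ ⟩
    count (isGap? w) m + count (isGap? w ∘ (m +_)) (N * m)
      ≡⟨ cong₂ _+_ (count-cong (isGap? w) (λ i → 0 <? w i) m (isGap-below w))
                   (count-cong (isGap? w ∘ (m +_)) (isGap? (pred ∘ w)) (N * m) λ {n} _ → isGap-shift w n) ⟩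
    count (λ i → 0 <? w i) m + count (isGap? (pred ∘ w)) (N * m)
      ≡⟨ cong (count (λ i → 0 <? w i) m +_) (count-gaps (pred ∘ w) N) ⟩
    count (λ i → 0 <? w i) m + sumBelow m (λ i → pred (w i) ⊓ N)
      ≡⟨ sumBelow-+ m _ _ ⟨
    sumBelow m (λ i → indicator (0 <? w i) + pred (w i) ⊓ N)
      ≡⟨ sumBelow-cong m (λ {i} _ → peel (w i)) ⟩
    sumBelow m (λ i → w i ⊓ suc N) ∎
    where
    open ≡-Reasoning
    peel : ∀ x → indicator (0 <? x) + pred x ⊓ N ≡ x ⊓ suc N
    peel zero    = refl
    peel (suc x) = refl

  length-gapList : ∀ w → length (gapList w) ≡ sumBelow m w
  length-gapList w = begin
    length (gapList w)                          ≡⟨ length-filter-applyUpTo (isGap? w) id (sumBelow m w * m) ⟩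
    count (isGap? w) (sumBelow m w * m)         ≡⟨ count-gaps w (sumBelow m w) ⟩
    sumBelow m (λ i → w i ⊓ sumBelow m w)       ≡⟨ sumBelow-cong m (λ i<m → m≤n⇒m⊓n≡m (≤-sumBelow m w i<m)) ⟩
    sumBelow m w                                ∎
    where open ≡-Reasoning

  gapList-numericalSemigroup : ∀ {w} → KunzInequalities w → IsNumericalSemigroup (semigroupWithGaps (gapList w))
  gapList-numericalSemigroup {w} K = record
    { zero∈    = λ 0∈ → <-irrefl (sym w0≡0) (to (isGap-below w 0<m) (to (∈-gapList w) 0∈))
    ; closed   = λ x y x∉ y∉ x+y∈ →
        nonGap-+ K (x∉ ∘ from (∈-gapList w)) (y∉ ∘ from (∈-gapList w)) (to (∈-gapList w) x+y∈)
    ; cofinite = gapList w , λ n ¬n∉ → decidable-stable (n ∈? gapList w) ¬n∉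
    }
    where open KunzInequalities K

  gapList-multiplicity⁺ : ∀ {w} → KunzInequalities w → (∀ {i} → 0 < i → i < m → 0 < w i) →
    HasMultiplicity (semigroupWithGaps (gapList w)) m
  gapList-multiplicity⁺ {w} K w>0 = record
    { nonzero = 0<m
    ; member  = λ m∈ →
        <-asym (subst₂ _<_ (n/n≡1 m) (trans (cong w (n%n≡0 m)) w0≡0) (to (∈-gapList w) m∈)) z<s
    ; least   = λ i 0<i i<m i∉ → i∉ (from (∈-gapList w) (from (isGap-below w i<m) (w>0 0<i i<m)))
    }
    where open KunzInequalities K

  gapList-multiplicity⁻ : ∀ w → HasMultiplicity (semigroupWithGaps (gapList w)) m →
    ∀ {i} → 0 < i → i < m → 0 < w i
  gapList-multiplicity⁻ w M {i} 0<i i<m =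
    to (isGap-below w i<m) (to (∈-gapList w) (decidable-stable (i ∈? gapList w) (least i 0<i i<m)))
    where open HasMultiplicity M

  module _ {G : List ℕ} (S : IsNumericalSemigroup (semigroupWithGaps G)) (m∉G : m ∉ G) where
    open IsNumericalSemigroup S

    private
      multiple∉ : ∀ q → q * m ∉ G
      multiple∉ zero    = zero∈
      multiple∉ (suc q) = closed m (q * m) m∉G (multiple∉ q)

      bound : ℕ
      bound = suc (sum G)

      beyond-bound : ∀ i → i + bound * m ∉ G
      beyond-bound i ∈G = <-irrefl refl (begin-strict
        i + bound * m   ≤⟨ ∈⇒≤sum ∈G ⟩
        sum G           <⟨ n<1+n (sum G) ⟩
        bound           ≤⟨ m≤m*n bound m ⟩
        bound * m       ≤⟨ m≤n+m (bound * m) i ⟩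
        i + bound * m   ∎)
        where open ≤-Reasoning

    -- i + apéryLevel i * m is the least element of the semigroup that is congruent to i.
    apéryLevel : ℕ → ℕ
    apéryLevel i = leastFailure (λ q → i + q * m ∈? G) bound

    private
      w = apéryLevel

      at-level : ∀ i → i + w i * m ∉ G
      at-level i = leastFailure-fails (λ q → i + q * m ∈? G) bound (beyond-bound i)

      above-level : ∀ i {q} → w i ≤ q → i + q * m ∉ G
      above-level i {q} w≤q =
        subst (_∉ G) (trans (regroup i (w i) (q ∸ w i) m) (cong (λ p → i + p * m) (m+[n∸m]≡n w≤q)))
          (closed _ _ (at-level i) (multiple∉ (q ∸ w i)))
        where
        regroup : ∀ i a b m → i + a * m + b * m ≡ i + (a + b) * m
        regroup = solve-∀

    ∈⇔<apéryLevel : ∀ i q → i + q * m ∈ G ⇔ q < apéryLevel i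
    ∈⇔<apéryLevel i q = mk⇔ (λ ∈G → ≰⇒> λ w≤q → above-level i w≤q ∈G)
      (leastFailure-below (λ q → i + q * m ∈? G) bound)

    apéryLevel-kunz : KunzInequalities apéryLevel
    apéryLevel-kunz = record
      { w0≡0        = n≤0⇒n≡0 (≮⇒≥ (zero∈ ∘ from (∈⇔<apéryLevel 0 0)))
      ; subadditive = λ {i} {j} _ _ → ≮⇒≥ λ lt → closed _ _ (at-level i) (at-level j)
          (subst (_∈ G) (sym (split i j)) (from (∈⇔<apéryLevel ((i + j) % m) _) lt))
      }
      where
      regroup : ∀ r d a b m → r + d * m + (a + b) * m ≡ r + (d + a + b) * m
      regroup = solve-∀
      reorder : ∀ i j a b m → i + a * m + (j + b * m) ≡ i + j + (a + b) * m
      reorder = solve-∀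
      split : ∀ i j → i + w i * m + (j + w j * m) ≡ (i + j) % m + ((i + j) / m + w i + w j) * m
      split i j = trans (reorder i j (w i) (w j) m)
        (trans (cong (_+ (w i + w j) * m) (m≡m%n+[m/n]*n (i + j) m))
          (regroup ((i + j) % m) ((i + j) / m) (w i) (w j) m))

    ∈⇔isGap-apéryLevel : ∀ {n} → n ∈ G ⇔ IsGap apéryLevel n
    ∈⇔isGap-apéryLevel {n} = ∈⇔<apéryLevel (n % m) (n / m) ⇔-∘ ≡⇒⇔ (cong (_∈ G) (m≡m%n+[m/n]*n n m))

    ≡gapList-apéryLevel : Linked _<_ G → G ≡ gapList apéryLevel
    ≡gapList-apéryLevel G↗ = Linked-<-≡ G↗ (gapList-sorted apéryLevel)
      (⇔-sym (∈-gapList apéryLevel) ⇔-∘ ∈⇔isGap-apéryLevel)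

-- Multiplicity four

open KunzCoordinates 4

kunz4 : ℕ → ℕ → ℕ → ℕ → ℕ
kunz4 a b k 1 = a
kunz4 a b k 2 = b
kunz4 a b k 3 = k
kunz4 a b k _ = 0

-- Of the Kunz inequalities for m = 4 only those for the residue sums 1 + 1, 1 + 2, 2 + 3
-- and 3 + 3 constrain (a, b, k).
record IsKunzTriple (a b k : ℕ) : Set where
  field
    1≤a     : 1 ≤ a
    1≤b     : 1 ≤ b
    1≤k     : 1 ≤ k
    b≤a+a   : b ≤ a + a
    k≤a+b   : k ≤ a + b
    a≤1+b+k : a ≤ suc (b + k)
    b≤1+k+k : b ≤ suc (k + k)

isKunzTriple? : ∀ a b k → Dec (IsKunzTriple a b k)
isKunzTriple? a b k = map′
  (λ (p₁ , p₂ , p₃ , p₄ , p₅ , p₆ , p₇) → record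
    { 1≤a = p₁ ; 1≤b = p₂ ; 1≤k = p₃ ; b≤a+a = p₄ ; k≤a+b = p₅ ; a≤1+b+k = p₆ ; b≤1+k+k = p₇ })
  (λ K → let open IsKunzTriple K in 1≤a , 1≤b , 1≤k , b≤a+a , k≤a+b , a≤1+b+k , b≤1+k+k)
  (1 ≤? a ×-dec 1 ≤? b ×-dec 1 ≤? k ×-dec
   b ≤? a + a ×-dec k ≤? a + b ×-dec a ≤? suc (b + k) ×-dec b ≤? suc (k + k))

kunzTriple⇒inequalities : ∀ {a b k} → IsKunzTriple a b k → KunzInequalities (kunz4 a b k)
kunzTriple⇒inequalities {a} {b} {k} K = record { w0≡0 = refl ; subadditive = table }
  where
  open IsKunzTriple K
  w = kunz4 a b k
  table : ∀ {i j} → i < 4 → j < 4 → w ((i + j) % 4) ≤ (i + j) / 4 + w i + w j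
  table {0} {0} _ _ = z≤n
  table {0} {1} _ _ = ≤-refl
  table {0} {2} _ _ = ≤-refl
  table {0} {3} _ _ = ≤-refl
  table {1} {0} _ _ = m≤m+n a 0
  table {1} {1} _ _ = b≤a+a
  table {1} {2} _ _ = k≤a+b
  table {1} {3} _ _ = z≤n
  table {2} {0} _ _ = m≤m+n b 0
  table {2} {1} _ _ = subst (k ≤_) (+-comm a b) k≤a+b
  table {2} {2} _ _ = z≤n
  table {2} {3} _ _ = a≤1+b+k
  table {3} {0} _ _ = m≤m+n k 0
  table {3} {1} _ _ = z≤n
  table {3} {2} _ _ = subst (λ x → a ≤ suc x) (+-comm b k) a≤1+b+k
  table {3} {3} _ _ = b≤1+k+k
  table {suc (suc (suc (suc _)))} (s<s (s<s (s<s (s<s ())))) _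
  table {_} {suc (suc (suc (suc _)))} _ (s<s (s<s (s<s (s<s ()))))

kunzTriple-positive : ∀ {a b k} → IsKunzTriple a b k → ∀ {i} → 0 < i → i < 4 → 0 < kunz4 a b k i
kunzTriple-positive K {1} _ _ = IsKunzTriple.1≤a K
kunzTriple-positive K {2} _ _ = IsKunzTriple.1≤b K
kunzTriple-positive K {3} _ _ = IsKunzTriple.1≤k K
kunzTriple-positive K {suc (suc (suc (suc _)))} _ (s<s (s<s (s<s (s<s ()))))

gapsOfTriple : ℕ → ℕ → ℕ → List ℕ
gapsOfTriple a b k = gapList (kunz4 a b k)

length-gapsOfTriple : ∀ a b k → length (gapsOfTriple a b k) ≡ a + b + k
length-gapsOfTriple a b k = trans (length-gapList (kunz4 a b k)) (regroup a b k)
  where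
  regroup : ∀ a b k → a + (b + (k + 0)) ≡ a + b + k
  regroup = solve-∀

gapsOfTriple-InS4g : ∀ {a b k} → IsKunzTriple a b k → InS4g (a + b + k) (gapsOfTriple a b k)
gapsOfTriple-InS4g {a} {b} {k} K =
  gapList-sorted (kunz4 a b k) ,
  gapList-numericalSemigroup (kunzTriple⇒inequalities K) ,
  gapList-multiplicity⁺ (kunzTriple⇒inequalities K) (kunzTriple-positive K) ,
  length-gapsOfTriple a b k

InS4g⇒kunzTriple : ∀ {g G} → InS4g g G →
  ∃[ a ] ∃[ b ] ∃[ k ] IsKunzTriple a b k × a + b + k ≡ g × G ≡ gapsOfTriple a b k
InS4g⇒kunzTriple {g} {G} (G↗ , S , M , length≡g) = w 1 , w 2 , w 3 , K , genus , G≡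
  where
  open HasMultiplicity M using (member)
  w = apéryLevel S member
  open KunzInequalities (apéryLevel-kunz S member)
  G≡gapList : G ≡ gapList w
  G≡gapList = ≡gapList-apéryLevel S member G↗
  positive : ∀ {i} → 0 < i → i < 4 → 0 < w i
  positive = gapList-multiplicity⁻ w (subst (λ L → HasMultiplicity (semigroupWithGaps L) 4) G≡gapList M)
  K : IsKunzTriple (w 1) (w 2) (w 3)
  K = record
    { 1≤a     = positive z<s (s<s z<s)
    ; 1≤b     = positive z<s (s<s (s<s z<s))
    ; 1≤k     = positive z<s (s<s (s<s (s<s z<s)))
    ; b≤a+a   = subadditive {1} {1} (s<s z<s) (s<s z<s)
    ; k≤a+b   = subadditive {1} {2} (s<s z<s) (s<s (s<s z<s))
    ; a≤1+b+k = subadditive {2} {3} (s<s (s<s z<s)) (s<s (s<s (s<s z<s)))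
    ; b≤1+k+k = subadditive {3} {3} (s<s (s<s (s<s z<s))) (s<s (s<s (s<s z<s)))
    }
  w≡kunz4 : ∀ {i} → i < 4 → w i ≡ kunz4 (w 1) (w 2) (w 3) i
  w≡kunz4 {0} _ = w0≡0
  w≡kunz4 {1} _ = refl
  w≡kunz4 {2} _ = refl
  w≡kunz4 {3} _ = refl
  w≡kunz4 {suc (suc (suc (suc _)))} (s<s (s<s (s<s (s<s ()))))
  G≡ : G ≡ gapsOfTriple (w 1) (w 2) (w 3)
  G≡ = trans G≡gapList (gapList-cong w≡kunz4)
  genus : w 1 + w 2 + w 3 ≡ g
  genus = trans (sym (length-gapsOfTriple (w 1) (w 2) (w 3))) (trans (cong length (sym G≡)) length≡g)

m+n<o⇔0<o∸m∸n : ∀ m n o → m + n < o ⇔ 0 < o ∸ m ∸ n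
m+n<o⇔0<o∸m∸n m n o = mk⇔
  (λ m+n<o → subst (0 <_) (sym (∸-+-assoc o m n)) (m+n≤o⇒m≤o∸n 1 m+n<o))
  (λ 0<o∸m∸n → 0<m∸n⇒n<m (subst (0 <_) (∸-+-assoc o m n) 0<o∸m∸n))

m+n+[o∸m∸n]≡o : ∀ m n {o} → m + n ≤ o → m + n + (o ∸ m ∸ n) ≡ o
m+n+[o∸m∸n]≡o m n {o} m+n≤o = trans (cong (m + n +_) (∸-+-assoc o m n)) (m+[n∸m]≡n m+n≤o)

m+n+o∸m∸n≡o : ∀ m n o → m + n + o ∸ m ∸ n ≡ o
m+n+o∸m∸n≡o m n o = trans (∸-+-assoc (m + n + o) m n) (m+n∸m≡n (m + n) o)

-- The field 1 ≤ k of IsKunzTriple rules out a truncated subtraction in g ∸ b ∸ a.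
IsKunzPair : ℕ → ℕ × ℕ → Set
IsKunzPair g (b , a) = IsKunzTriple a b (g ∸ b ∸ a)

isKunzPair? : ∀ g → Decidable (IsKunzPair g)
isKunzPair? g (b , a) = isKunzTriple? a b (g ∸ b ∸ a)

kunzPair-genus : ∀ {g b a} → IsKunzPair g (b , a) → b + a + (g ∸ b ∸ a) ≡ g
kunzPair-genus {g} {b} {a} K =
  m+n+[o∸m∸n]≡o b a (<⇒≤ (from (m+n<o⇔0<o∸m∸n b a g) (IsKunzTriple.1≤k K)))

gapsOfPair : ℕ → ℕ × ℕ → List ℕ
gapsOfPair g (b , a) = gapsOfTriple a b (g ∸ b ∸ a)

semigroups4 : ℕ → List (List ℕ)
semigroups4 g = map (gapsOfPair g) (filter (isKunzPair? g) (cartesianProduct (upTo g) (upTo g)))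

gapsOfPair-InS4g : ∀ {g x} → IsKunzPair g x → InS4g g (gapsOfPair g x)
gapsOfPair-InS4g {g} {b , a} K =
  subst (λ n → InS4g n (gapsOfPair g (b , a))) (trans (cong (_+ (g ∸ b ∸ a)) (+-comm a b)) (kunzPair-genus K))
    (gapsOfTriple-InS4g K)

gapsOfPair-injective : ∀ {g x y} → gapsOfPair g x ≡ gapsOfPair g y → x ≡ y
gapsOfPair-injective {g} {b , a} {b′ , a′} eq = cong₂ _,_
  (≤-antisym (gapList-injective w w′ eq {2} 2<4) (gapList-injective w′ w (sym eq) {2} 2<4))
  (≤-antisym (gapList-injective w w′ eq {1} 1<4) (gapList-injective w′ w (sym eq) {1} 1<4))
  where
  w  = kunz4 a b (g ∸ b ∸ a)
  w′ = kunz4 a′ b′ (g ∸ b′ ∸ a′)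
  1<4 : 1 < 4
  1<4 = s<s z<s
  2<4 : 2 < 4
  2<4 = s<s (s<s z<s)

semigroups4-sound : ∀ {g G} → G ∈ semigroups4 g → InS4g g G
semigroups4-sound {g} G∈ with x , x∈ , refl ← ∈-map⁻ (gapsOfPair g) G∈ =
  gapsOfPair-InS4g (proj₂ (∈-filter⁻ (isKunzPair? g) {xs = cartesianProduct (upTo g) (upTo g)} x∈))

semigroups4-complete : ∀ {g G} → InS4g g G → G ∈ semigroups4 g
semigroups4-complete {g} H with a , b , k , K , refl , refl ← InS4g⇒kunzTriple H =
  subst (λ k′ → gapsOfTriple a b k′ ∈ semigroups4 g) k≡
    (∈-map⁺ (gapsOfPair g)
      (∈-filter⁺ (isKunzPair? g) (∈-cartesianProduct⁺ (∈-upTo⁺ b<g) (∈-upTo⁺ a<g)) K′))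
  where
  g≡ : a + b + k ≡ b + a + k
  g≡ = cong (_+ k) (+-comm a b)
  b+a<g : b + a < a + b + k
  b+a<g = subst (b + a <_) (sym g≡) (m<m+n (b + a) (IsKunzTriple.1≤k K))
  b<g : b < a + b + k
  b<g = ≤-<-trans (m≤m+n b a) b+a<g
  a<g : a < a + b + k
  a<g = ≤-<-trans (m≤n+m a b) b+a<g
  k≡ : a + b + k ∸ b ∸ a ≡ k
  k≡ = trans (cong (λ n → n ∸ b ∸ a) g≡) (m+n+o∸m∸n≡o b a k)
  K′ : IsKunzTriple a b (a + b + k ∸ b ∸ a)
  K′ = subst (IsKunzTriple a b) (sym k≡) K

semigroups4-cardinality : ∀ g → HasCardinality (InS4g g) (length (semigroups4 g))
semigroups4-cardinality g =
  semigroups4 g ,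
  Unique.map⁺ gapsOfPair-injective
    (Unique.filter⁺ (isKunzPair? g) (Unique.cartesianProduct⁺ (Unique.upTo⁺ g) (Unique.upTo⁺ g))) ,
  All.tabulate semigroups4-sound ,
  (λ _ → semigroups4-complete) ,
  refl

-- Counting Kunz triples of genus g

n*3≡n+n+n : ∀ n → n * 3 ≡ n + n + n
n*3≡n+n+n = solve-∀

m+m<n+n⇒m<n : ∀ {m n} → m + m < n + n → m < n
m+m<n+n⇒m<n m+m<n+n = ≰⇒> λ n≤m → <⇒≱ m+m<n+n (+-mono-≤ n≤m n≤m)

module _ {a b k t : ℕ} where
  private
    thirds : b + t + (b + b) ≡ b * 3 + t
    thirds = regroup b t
      where
      regroup : ∀ b t → b + t + (b + b) ≡ b * 3 + t
      regroup = solve-∀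
    swap : b + a + (a + b) ≡ a + a + (b + b)
    swap = regroup a b
      where
      regroup : ∀ a b → b + a + (a + b) ≡ a + a + (b + b)
      regroup = solve-∀
    lift : a + suc (b + k) ≡ suc (b + a + k)
    lift = regroup a b k
      where
      regroup : ∀ a b k → a + suc (b + k) ≡ suc (b + a + k)
      regroup = solve-∀

  kunzTriple⇒small-bounds : b + a + k ≡ b * 3 + t → IsKunzTriple a b k →
    b + t ≤ a + a × a + a ≤ suc (b * 3 + t)
  kunzTriple⇒small-bounds g≡ K = +-cancelʳ-≤ (b + b) (b + t) (a + a) lower , upper
    where
    open IsKunzTriple K
    open ≤-Reasoning
    lower = begin
      b + t + (b + b)   ≡⟨ trans thirds (sym g≡) ⟩
      b + a + k         ≤⟨ +-monoʳ-≤ (b + a) k≤a+b ⟩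
      b + a + (a + b)   ≡⟨ swap ⟩
      a + a + (b + b)   ∎
    upper = begin
      a + a             ≤⟨ +-monoʳ-≤ a a≤1+b+k ⟩
      a + suc (b + k)   ≡⟨ trans lift (cong suc g≡) ⟩
      suc (b * 3 + t)   ∎

  small-bounds⇒kunzTriple : 1 ≤ b → 1 ≤ k → 2 ≤ b + t → b + a + k ≡ b * 3 + t →
    b + t ≤ a + a → a + a ≤ suc (b * 3 + t) → IsKunzTriple a b k
  small-bounds⇒kunzTriple 1≤b 1≤k 2≤b+t g≡ lower upper = record
    { 1≤a     = from (⌈n/2⌉≤⇔ 2 a) (≤-trans 2≤b+t lower)
    ; 1≤b     = 1≤b
    ; 1≤k     = 1≤k
    ; b≤a+a   = ≤-trans (m≤m+n b t) lower
    ; k≤a+b   = +-cancelˡ-≤ (b + a) k (a + b) (begin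
        b + a + k         ≡⟨ trans g≡ (sym thirds) ⟩
        b + t + (b + b)   ≤⟨ +-monoˡ-≤ (b + b) lower ⟩
        a + a + (b + b)   ≡⟨ swap ⟨
        b + a + (a + b)   ∎)
    ; a≤1+b+k = +-cancelˡ-≤ a a (suc (b + k)) (begin
        a + a             ≤⟨ upper ⟩
        suc (b * 3 + t)   ≡⟨ trans (cong suc (sym g≡)) (sym lift) ⟩
        a + suc (b + k)   ∎)
    ; b≤1+k+k = ≤-trans (m≤m+n b t) (+-cancelʳ-≤ (b + b) (b + t) (suc (k + k)) (begin
        b + t + (b + b)           ≡⟨ trans thirds (sym g≡) ⟩
        b + a + k                 ≤⟨ g≤ ⟩
        suc (k + k) + (b + b)     ∎))
    }
    where
    open ≤-Reasoning
    spread : ∀ a b k → b + a + k + (b + a + k) ≡ a + a + (k + k + (b + b))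
    spread = solve-∀
    shift : ∀ g k b → suc g + (k + k + (b + b)) ≡ g + (suc (k + k) + (b + b))
    shift = solve-∀
    g≤ : b + a + k ≤ suc (k + k) + (b + b)
    g≤ = +-cancelˡ-≤ (b + a + k) (b + a + k) _ (begin
      b + a + k + (b + a + k)          ≡⟨ spread a b k ⟩
      a + a + (k + k + (b + b))        ≤⟨ +-monoˡ-≤ _ (≤-trans upper (≤-reflexive (cong suc (sym g≡)))) ⟩
      suc (b + a + k) + (k + k + (b + b))  ≡⟨ shift (b + a + k) k b ⟩
      b + a + k + (suc (k + k) + (b + b))  ∎)

small-bounds⇒b+a<g : ∀ {a b t} → 2 ≤ b + t → a + a ≤ suc (b * 3 + t) → b + a < b * 3 + t
small-bounds⇒b+a<g {a} {b} {t} 2≤b+t upper = m+m<n+n⇒m<n (begin-strict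
  b + a + (b + a)             ≡⟨ double b a ⟩
  b + b + (a + a)             ≤⟨ +-monoʳ-≤ (b + b) upper ⟩
  b + b + suc (b * 3 + t)     ≡⟨ +-suc (b + b) (b * 3 + t) ⟩
  suc (b + b) + (b * 3 + t)   <⟨ +-monoˡ-< (b * 3 + t) (+-monoˡ-≤ (b + b) 2≤b+t) ⟩
  b + t + (b + b) + (b * 3 + t) ≡⟨ cong (_+ (b * 3 + t)) (thirds b t) ⟩
  b * 3 + t + (b * 3 + t)     ∎)
  where
  open ≤-Reasoning
  double : ∀ b a → b + a + (b + a) ≡ b + b + (a + a)
  double = solve-∀
  thirds : ∀ b t → b + t + (b + b) ≡ b * 3 + t
  thirds = solve-∀

kunzPair⇔small : ∀ {b t a} → 1 ≤ b → 2 ≤ b + t →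
  IsKunzPair (b * 3 + t) (b , a) ⇔ (⌈ b + t /2⌉ ≤ a × a < suc ⌈ b * 3 + t /2⌉)
kunzPair⇔small {b} {t} {a} 1≤b 2≤b+t = mk⇔
  (λ K → let lower , upper = kunzTriple⇒small-bounds (kunzPair-genus {b * 3 + t} {b} {a} K) K
         in from (⌈n/2⌉≤⇔ (b + t) a) lower , s≤s (from (≤⌊n/2⌋⇔ a (suc (b * 3 + t))) upper))
  (λ (lo≤a , a<hi) →
    let upper = to (≤⌊n/2⌋⇔ a (suc (b * 3 + t))) (s≤s⁻¹ a<hi)
        b+a<g = small-bounds⇒b+a<g {a} {b} {t} 2≤b+t upper
    in small-bounds⇒kunzTriple {a} {b} {b * 3 + t ∸ b ∸ a} {t} 1≤b (to (m+n<o⇔0<o∸m∸n b a _) b+a<g) 2≤b+t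
         (m+n+[o∸m∸n]≡o b a (<⇒≤ b+a<g)) (to (⌈n/2⌉≤⇔ (b + t) a) lo≤a) upper)

module _ {a b k g : ℕ} where
  private
    interchange : b + b + (a + a) ≡ b + a + (b + a)
    interchange = regroup b a
      where
      regroup : ∀ b a → b + b + (a + a) ≡ b + a + (b + a)
      regroup = solve-∀
    rotate : b + k + suc a ≡ suc (b + a + k)
    rotate = regroup b a k
      where
      regroup : ∀ b a k → b + k + suc a ≡ suc (b + a + k)
      regroup = solve-∀
    interleave : b + b + suc (k + k) ≡ b + k + suc (b + k)
    interleave = regroup b k
      where
      regroup : ∀ b k → b + b + suc (k + k) ≡ b + k + suc (b + k)
      regroup = solve-∀

  large-bounds⇒kunzTriple : 2 ≤ b → g < b * 3 → b + a + k ≡ g →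
    b ≤ a + a → ⌊ b /2⌋ ≤ k → IsKunzTriple a b k
  large-bounds⇒kunzTriple 2≤b g<3b g≡ b≤a+a h≤k = record
    { 1≤a     = from (⌈n/2⌉≤⇔ 2 a) (≤-trans 2≤b b≤a+a)
    ; 1≤b     = ≤-trans (s≤s z≤n) 2≤b
    ; 1≤k     = ≤-trans (⌊n/2⌋-mono 2≤b) h≤k
    ; b≤a+a   = b≤a+a
    ; k≤a+b   = subst (k ≤_) (+-comm b a) (<⇒≤ (+-cancelˡ-≤ (b + a) (suc k) (b + a) (begin
        b + a + suc k       ≡⟨ +-suc (b + a) k ⟩
        suc (b + a + k)     ≤⟨ three-b ⟩
        b + b + b           ≤⟨ +-monoʳ-≤ (b + b) b≤a+a ⟩
        b + b + (a + a)     ≡⟨ interchange ⟩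
        b + a + (b + a)     ∎)))
    ; a≤1+b+k = m≤n⇒m≤1+n (s≤s⁻¹ (+-cancelˡ-≤ (b + k) (suc a) (suc (b + k)) (begin
        b + k + suc a       ≡⟨ rotate ⟩
        suc (b + a + k)     ≤⟨ three-b ⟩
        b + b + b           ≤⟨ +-monoʳ-≤ (b + b) b≤1+k+k ⟩
        b + b + suc (k + k) ≡⟨ interleave ⟩
        b + k + suc (b + k) ∎)))
    ; b≤1+k+k = b≤1+k+k
    }
    where
    open ≤-Reasoning
    b≤1+k+k : b ≤ suc (k + k)
    b≤1+k+k = to (⌊n/2⌋≤⇔ b k) h≤k
    three-b : suc (b + a + k) ≤ b + b + b
    three-b = ≤-trans (≤-reflexive (cong suc g≡)) (≤-trans g<3b (≤-reflexive (n*3≡n+n+n b)))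

0<m≤o∸n⇒n≤o∸m : ∀ {m n o} → 0 < m → m ≤ o ∸ n → n ≤ o ∸ m
0<m≤o∸n⇒n≤o∸m {m} {n} {o} 0<m m≤o∸n =
  m+n≤o⇒m≤o∸n n (subst (_≤ o) (+-comm m n) (m≤o∸n⇒m+n≤o m n≤o m≤o∸n))
  where
  n≤o : n ≤ o
  n≤o = <⇒≤ (0<m∸n⇒n<m (≤-trans 0<m m≤o∸n))

kunzPair⇔large : ∀ {g b a} → 2 ≤ b → g < b * 3 →
  IsKunzPair g (b , a) ⇔ (⌈ b /2⌉ ≤ a × a < suc (g ∸ b ∸ ⌊ b /2⌋))
kunzPair⇔large {g} {b} {a} 2≤b g<3b = mk⇔
  (λ K → let open IsKunzTriple K
         in from (⌈n/2⌉≤⇔ b a) b≤a+a ,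
            s≤s (0<m≤o∸n⇒n≤o∸m 1≤h (from (⌊n/2⌋≤⇔ b (g ∸ b ∸ a)) b≤1+k+k)))
  (λ (lo≤a , a<hi) →
    let b≤a+a = to (⌈n/2⌉≤⇔ b a) lo≤a
        h≤k   = 0<m≤o∸n⇒n≤o∸m (from (⌈n/2⌉≤⇔ 2 a) (≤-trans 2≤b b≤a+a)) (s≤s⁻¹ a<hi)
        b+a<g = from (m+n<o⇔0<o∸m∸n b a g) (≤-trans 1≤h h≤k)
    in large-bounds⇒kunzTriple 2≤b g<3b (m+n+[o∸m∸n]≡o b a (<⇒≤ b+a<g)) b≤a+a h≤k)
  where
  1≤h : 1 ≤ ⌊ b /2⌋
  1≤h = ⌊n/2⌋-mono 2≤b

sliceSize : ℕ → ℕ → ℕ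
sliceSize g zero        = 0
sliceSize g b@(suc _) with b * 3 ≤? g
... | yes _ = suc b
... | no  _ = suc g ∸ (b + b)

sliceSum : ℕ → ℕ
sliceSum g = sumBelow g (sliceSize g)

[1+m]∸n≡m∸n+[n≤m] : ∀ m n → suc m ∸ n ≡ m ∸ n + indicator (n ≤? m)
[1+m]∸n≡m∸n+[n≤m] m n = by-cases (n ≤? m)
  where
  by-cases : (n≤m? : Dec (n ≤ m)) → suc m ∸ n ≡ m ∸ n + indicator n≤m?
  by-cases (yes n≤m) = trans (+-∸-assoc 1 n≤m) (+-comm 1 (m ∸ n))
  by-cases (no n≰m)  = trans (m≤n⇒m∸n≡0 m<n) (sym (trans (+-identityʳ (m ∸ n)) (m≤n⇒m∸n≡0 (<⇒≤ m<n))))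
    where m<n = ≰⇒> n≰m

m∸1+n<m : ∀ {m} n → 0 < m → m ∸ suc n < m
m∸1+n<m n (s≤s {n = m} _) = s≤s (m∸n≤m m n)

large-slice-size : ∀ g b → 1 ≤ b → suc (g ∸ b ∸ ⌊ b /2⌋) ∸ ⌈ b /2⌉ ≡ suc g ∸ (b + b)
large-slice-size g b 1≤b with b + ⌊ b /2⌋ ≤? g
... | yes fits = begin
  suc (g ∸ b ∸ ⌊ b /2⌋) ∸ ⌈ b /2⌉
    ≡⟨ cong (λ n → suc n ∸ ⌈ b /2⌉) (∸-+-assoc g b ⌊ b /2⌋) ⟩
  suc (g ∸ (b + ⌊ b /2⌋)) ∸ ⌈ b /2⌉
    ≡⟨ cong (_∸ ⌈ b /2⌉) (+-∸-assoc 1 fits) ⟨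
  suc g ∸ (b + ⌊ b /2⌋) ∸ ⌈ b /2⌉
    ≡⟨ ∸-+-assoc (suc g) (b + ⌊ b /2⌋) ⌈ b /2⌉ ⟩
  suc g ∸ (b + ⌊ b /2⌋ + ⌈ b /2⌉)
    ≡⟨ cong (λ n → suc g ∸ n) (trans (+-assoc b _ _) (cong (b +_) (⌊n/2⌋+⌈n/2⌉≡n b))) ⟩
  suc g ∸ (b + b) ∎
  where open ≡-Reasoning
... | no overflows = trans (cong (λ n → suc n ∸ ⌈ b /2⌉) g∸b∸h≡0) (trans (m≤n⇒m∸n≡0 (⌈n/2⌉-mono 1≤b))
    (sym (m≤n⇒m∸n≡0 (≤-trans (≰⇒> overflows) (+-monoʳ-≤ b (⌊n/2⌋≤n b))))))
  where
  g∸b∸h≡0 : g ∸ b ∸ ⌊ b /2⌋ ≡ 0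
  g∸b∸h≡0 = trans (∸-+-assoc g b ⌊ b /2⌋) (m≤n⇒m∸n≡0 (<⇒≤ (≰⇒> overflows)))

4≤3b+t⇒2≤b+t : ∀ b t → 4 ≤ suc b * 3 + t → 2 ≤ suc b + t
4≤3b+t⇒2≤b+t zero    t 4≤3+t = s≤s⁻¹ (s≤s⁻¹ 4≤3+t)
4≤3b+t⇒2≤b+t (suc b) t _     = s≤s (s≤s z≤n)

4≤g<3b⇒2≤b : ∀ b {g} → 4 ≤ g → g < suc b * 3 → 2 ≤ suc b
4≤g<3b⇒2≤b zero    4≤g g<3 = ⊥-elim (<⇒≱ g<3 (≤-trans (s≤s (s≤s (s≤s z≤n))) 4≤g))
4≤g<3b⇒2≤b (suc b) _   _   = s≤s (s≤s z≤n)

count-small-slice : ∀ b t → 4 ≤ suc b * 3 + t →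
  count (λ a → isKunzPair? (suc b * 3 + t) (suc b , a)) (suc b * 3 + t) ≡ suc (suc b)
count-small-slice b t 4≤g = begin
  count (λ a → isKunzPair? g (B , a)) g
    ≡⟨ count-cong (λ a → isKunzPair? g (B , a)) (λ a → lo ≤? a ×-dec a <? hi) g
         (λ _ → kunzPair⇔small (s≤s z≤n) 2≤B+t) ⟩
  count (λ a → lo ≤? a ×-dec a <? hi) g
    ≡⟨ count-interval lo hi g ⟩
  g ⊓ hi ∸ lo
    ≡⟨ cong (_∸ lo) (m≥n⇒m⊓n≡n (⌈n/2⌉<n (suc (b * 3 + t)))) ⟩
  hi ∸ lo
    ≡⟨ cong (λ n → suc n ∸ lo) (trans (cong ⌈_/2⌉ (regroup b t)) (⌈[m*2+n]/2⌉≡m+⌈n/2⌉ B (B + t))) ⟩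
  suc (B + lo) ∸ lo
    ≡⟨ m+n∸n≡m (suc B) lo ⟩
  suc B ∎
  where
  open ≡-Reasoning
  B = suc b
  g = B * 3 + t
  lo = ⌈ B + t /2⌉
  hi = suc ⌈ g /2⌉
  2≤B+t : 2 ≤ B + t
  2≤B+t = 4≤3b+t⇒2≤b+t b t 4≤g
  regroup : ∀ b t → suc b * 3 + t ≡ suc b * 2 + (suc b + t)
  regroup = solve-∀

count-large-slice : ∀ {g} b → 4 ≤ g → g < suc b * 3 →
  count (λ a → isKunzPair? g (suc b , a)) g ≡ suc g ∸ (suc b + suc b)
count-large-slice {g} b 4≤g g<3B = begin
  count (λ a → isKunzPair? g (B , a)) g
    ≡⟨ count-cong (λ a → isKunzPair? g (B , a)) (λ a → lo ≤? a ×-dec a <? hi) g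
         (λ _ → kunzPair⇔large 2≤B g<3B) ⟩
  count (λ a → lo ≤? a ×-dec a <? hi) g
    ≡⟨ count-interval lo hi g ⟩
  g ⊓ hi ∸ lo
    ≡⟨ cong (_∸ lo) (m≥n⇒m⊓n≡n hi≤g) ⟩
  hi ∸ lo
    ≡⟨ large-slice-size g B (s≤s z≤n) ⟩
  suc g ∸ (B + B) ∎
  where
  open ≡-Reasoning
  B = suc b
  lo = ⌈ B /2⌉
  hi = suc (g ∸ B ∸ ⌊ B /2⌋)
  2≤B : 2 ≤ B
  2≤B = 4≤g<3b⇒2≤b b 4≤g g<3B
  hi≤g : hi ≤ g
  hi≤g = ≤-<-trans (m∸n≤m (g ∸ B) ⌊ B /2⌋) (m∸1+n<m b (≤-trans (s≤s z≤n) 4≤g))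

count-slice : ∀ {g b} → 4 ≤ g → count (λ a → isKunzPair? g (b , a)) g ≡ sliceSize g b
count-slice {g} {zero}  _ = count-none (λ a → isKunzPair? g (0 , a)) g λ _ K → 1≰0 (IsKunzTriple.1≤b K)
  where
  1≰0 : ¬ 1 ≤ 0
  1≰0 ()
count-slice {g} {suc b} 4≤g with suc b * 3 ≤? g
... | yes 3b≤g = subst (λ n → count (λ a → isKunzPair? n (suc b , a)) n ≡ suc (suc b)) (m+[n∸m]≡n 3b≤g)
                   (count-small-slice b (g ∸ suc b * 3) (subst (4 ≤_) (sym (m+[n∸m]≡n 3b≤g)) 4≤g))
... | no 3b≰g  = count-large-slice b 4≤g (≰⇒> 3b≰g)

length-semigroups4 : ∀ {g} → 4 ≤ g → length (semigroups4 g) ≡ sliceSum g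
length-semigroups4 {g} 4≤g = begin
  length (semigroups4 g)
    ≡⟨ length-map (gapsOfPair g) (filter (isKunzPair? g) (cartesianProduct (upTo g) (upTo g))) ⟩
  length (filter (isKunzPair? g) (cartesianProduct (upTo g) (upTo g)))
    ≡⟨ length-filter-cartesianProduct (isKunzPair? g) id g (upTo g) ⟩
  sumBelow g (λ b → length (filter (λ a → isKunzPair? g (b , a)) (upTo g)))
    ≡⟨ sumBelow-cong g (λ {b} _ →
         trans (length-filter-applyUpTo (λ a → isKunzPair? g (b , a)) id g) (count-slice {g} {b} 4≤g)) ⟩
  sliceSum g ∎
  where open ≡-Reasoning

sliceSize-vanishes : ∀ {g b} → g ≤ b → sliceSize g b ≡ 0
sliceSize-vanishes {g} {zero}  _   = refl
sliceSize-vanishes {g} {suc b} g≤b with suc b * 3 ≤? g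
... | yes 3b≤g = ⊥-elim (<⇒≱ (m<m*n (suc b) 3 (s≤s (s≤s z≤n))) (≤-trans 3b≤g g≤b))
... | no  _    = m≤n⇒m∸n≡0 (s≤s (≤-trans g≤b (m≤n+m (suc b) b)))

sliceSize-step : ∀ g b → sliceSize (3 + g) (2 + b) ≡ sliceSize g (1 + b) + indicator (suc b + suc b ≤? suc g)
sliceSize-step g b with suc (suc b) * 3 ≤? 3 + g | suc b * 3 ≤? g
... | yes _     | yes 3b≤g =
  trans (+-comm 1 (suc (suc b))) (cong (suc (suc b) +_) (sym (indicator-yes (suc b + suc b ≤? suc g) 2b≤1+g)))
  where
  2b≤1+g : suc b + suc b ≤ suc g
  2b≤1+g = ≤-trans (m≤m+n (suc b + suc b) (suc b))
                   (≤-trans (≤-reflexive (sym (n*3≡n+n+n (suc b)))) (m≤n⇒m≤1+n 3b≤g))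
... | yes 3b≤g  | no 3b≰g   = ⊥-elim (3b≰g (s≤s⁻¹ (s≤s⁻¹ (s≤s⁻¹ 3b≤g))))
... | no 3b≰g   | yes 3b≤g  = ⊥-elim (3b≰g (s≤s (s≤s (s≤s 3b≤g))))
... | no _      | no _      =
  trans (cong (suc (suc (suc g)) ∸_) (+-suc (suc b) (suc b))) ([1+m]∸n≡m∸n+[n≤m] (suc g) (suc b + suc b))

count-halves : ∀ g → count (λ b → suc b + suc b ≤? suc g) (suc g) ≡ ⌈ g /2⌉
count-halves g = begin
  count (λ b → suc b + suc b ≤? suc g) (suc g)
    ≡⟨ count-cong (λ b → suc b + suc b ≤? suc g) (λ b → 0 ≤? b ×-dec b <? ⌈ g /2⌉) (suc g) (λ {b} _ →
         mk⇔ (λ le → z≤n , from (≤⌊n/2⌋⇔ (suc b) (suc g)) le) (λ (_ , lt) → to (≤⌊n/2⌋⇔ (suc b) (suc g)) lt)) ⟩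
  count (λ b → 0 ≤? b ×-dec b <? ⌈ g /2⌉) (suc g)
    ≡⟨ count-interval 0 ⌈ g /2⌉ (suc g) ⟩
  suc g ⊓ ⌈ g /2⌉
    ≡⟨ m≥n⇒m⊓n≡n (m≤n⇒m≤1+n (⌈n/2⌉≤n g)) ⟩
  ⌈ g /2⌉ ∎
  where open ≡-Reasoning

sliceSum-step3 : ∀ g → sliceSum (3 + g) ≡ sliceSum g + 2 + ⌈ g /2⌉
sliceSum-step3 g = begin
  sliceSum (3 + g)
    ≡⟨⟩
  2 + sumBelow (suc g) (λ b → sliceSize (3 + g) (2 + b))
    ≡⟨ cong (2 +_) (sumBelow-cong (suc g) (λ {b} _ → sliceSize-step g b)) ⟩
  2 + sumBelow (suc g) (λ b → sliceSize g (1 + b) + indicator (suc b + suc b ≤? suc g))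
    ≡⟨ cong (2 +_) (sumBelow-+ (suc g) (sliceSize g ∘ suc) (λ b → indicator (suc b + suc b ≤? suc g))) ⟩
  2 + (sumBelow (2 + g) (sliceSize g) + count (λ b → suc b + suc b ≤? suc g) (suc g))
    ≡⟨ cong₂ (λ x y → 2 + (x + y)) drop-vanishing (count-halves g) ⟩
  2 + (sliceSum g + ⌈ g /2⌉)
    ≡⟨ reorder 2 (sliceSum g) ⌈ g /2⌉ ⟩
  sliceSum g + 2 + ⌈ g /2⌉ ∎
  where
  open ≡-Reasoning
  reorder : ∀ a b c → a + (b + c) ≡ b + a + c
  reorder = solve-∀
  drop-vanishing : sumBelow (2 + g) (sliceSize g) ≡ sliceSum g
  drop-vanishing = begin
    sumBelow (2 + g) (sliceSize g)
      ≡⟨ sumBelow-suc (suc g) (sliceSize g) ⟩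
    sumBelow (1 + g) (sliceSize g) + sliceSize g (suc g)
      ≡⟨ cong₂ _+_ (sumBelow-suc g (sliceSize g)) (sliceSize-vanishes (n≤1+n g)) ⟩
    sumBelow g (sliceSize g) + sliceSize g g + 0
      ≡⟨ trans (+-identityʳ _) (cong (sumBelow g (sliceSize g) +_) (sliceSize-vanishes {g} ≤-refl)) ⟩
    sumBelow g (sliceSize g) + 0
      ≡⟨ +-identityʳ _ ⟩
    sliceSum g ∎

sliceSum-step6 : ∀ g → sliceSum (6 + g) ≡ sliceSum g + (6 + g)
sliceSum-step6 g = begin
  sliceSum (3 + (3 + g))
    ≡⟨ sliceSum-step3 (3 + g) ⟩
  sliceSum (3 + g) + 2 + (2 + ⌊ g /2⌋)
    ≡⟨ cong (λ s → s + 2 + (2 + ⌊ g /2⌋)) (sliceSum-step3 g) ⟩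
  sliceSum g + 2 + ⌈ g /2⌉ + 2 + (2 + ⌊ g /2⌋)
    ≡⟨ reorder (sliceSum g) ⌈ g /2⌉ ⌊ g /2⌋ ⟩
  sliceSum g + (6 + (⌊ g /2⌋ + ⌈ g /2⌉))
    ≡⟨ cong (λ n → sliceSum g + (6 + n)) (⌊n/2⌋+⌈n/2⌉≡n g) ⟩
  sliceSum g + (6 + g) ∎
  where
  open ≡-Reasoning
  reorder : ∀ s c f → s + 2 + c + 2 + (2 + f) ≡ s + (6 + (f + c))
  reorder = solve-∀

sliceSum-step12 : ∀ g → sliceSum (12 + g) ≡ sliceSum g + (18 + 2 * g)
sliceSum-step12 g = begin
  sliceSum (6 + (6 + g))               ≡⟨ sliceSum-step6 (6 + g) ⟩
  sliceSum (6 + g) + (6 + (6 + g))     ≡⟨ cong (_+ (12 + g)) (sliceSum-step6 g) ⟩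
  sliceSum g + (6 + g) + (12 + g)      ≡⟨ reorder (sliceSum g) g ⟩
  sliceSum g + (18 + 2 * g)            ∎
  where
  open ≡-Reasoning
  reorder : ∀ s g → s + (6 + g) + (12 + g) ≡ s + (18 + 2 * g)
  reorder = solve-∀

-- The closed formula

open TwiceFormula

[kn+m]/n≡m/n+k : ∀ k n m .{{_ : NonZero n}} → (k * n + m) / n ≡ m / n + k
[kn+m]/n≡m/n+k k n m = trans (cong (_/ n) (+-comm (k * n) m)) ([m+kn]/n≡m/n+k m k n)

n/2≡⌊n/2⌋ : ∀ n → n / 2 ≡ ⌊ n /2⌋
n/2≡⌊n/2⌋ zero          = refl
n/2≡⌊n/2⌋ (suc zero)    = refl
n/2≡⌊n/2⌋ (suc (suc n)) =
  trans ([kn+m]/n≡m/n+k 1 2 n) (trans (cong (_+ 1) (n/2≡⌊n/2⌋ n)) (+-comm ⌊ n /2⌋ 1))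

n/2+[n+1]/2≡n : ∀ n → n / 2 + (n + 1) / 2 ≡ n
n/2+[n+1]/2≡n n =
  trans (cong₂ _+_ (n/2≡⌊n/2⌋ n) (trans (cong (_/ 2) (+-comm n 1)) (n/2≡⌊n/2⌋ (suc n)))) (⌊n/2⌋+⌈n/2⌉≡n n)

ceil8[2n∸3]≡[n+2]/4 : ∀ n → 2 ≤ n → ceil8 (2 * n ∸ 3) ≡ (n + 2) / 4
ceil8[2n∸3]≡[n+2]/4 1             (s≤s ())
ceil8[2n∸3]≡[n+2]/4 (suc (suc h)) _ = begin
  (2 * (2 + h) ∸ 3 + 7) / 8           ≡⟨ cong (λ x → (x ∸ 3 + 7) / 8) (double h) ⟩
  ((1 + 2 * h) + 3 ∸ 3 + 7) / 8       ≡⟨ cong (λ x → (x + 7) / 8) (m+n∸n≡m (1 + 2 * h) 3) ⟩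
  (1 + 2 * h + 7) / 8                 ≡⟨ cong (_/ 8) (halve h) ⟩
  (2 + h + 2) * 2 / (4 * 2)           ≡⟨ m*n/o*n≡m/o (2 + h + 2) 2 4 ⟩
  (2 + h + 2) / 4                     ∎
  where
  open ≡-Reasoning
  double : ∀ h → 2 * (2 + h) ≡ (1 + 2 * h) + 3
  double = solve-∀
  halve : ∀ h → 1 + 2 * h + 7 ≡ (2 + h + 2) * 2
  halve = solve-∀

ceil8[2n∸7]≡n/4 : ∀ n → 4 ≤ n → ceil8 (2 * n ∸ 7) ≡ n / 4
ceil8[2n∸7]≡n/4 1 (s≤s ())
ceil8[2n∸7]≡n/4 2 (s≤s (s≤s ()))
ceil8[2n∸7]≡n/4 3 (s≤s (s≤s (s≤s ())))
ceil8[2n∸7]≡n/4 (suc (suc (suc (suc h)))) _ = begin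
  (2 * (4 + h) ∸ 7 + 7) / 8           ≡⟨ cong (λ x → (x ∸ 7 + 7) / 8) (double h) ⟩
  ((1 + 2 * h) + 7 ∸ 7 + 7) / 8       ≡⟨ cong (λ x → (x + 7) / 8) (m+n∸n≡m (1 + 2 * h) 7) ⟩
  (1 + 2 * h + 7) / 8                 ≡⟨ cong (_/ 8) (halve h) ⟩
  (4 + h) * 2 / (4 * 2)               ≡⟨ m*n/o*n≡m/o (4 + h) 2 4 ⟩
  (4 + h) / 4                         ∎
  where
  open ≡-Reasoning
  double : ∀ h → 2 * (4 + h) ≡ (1 + 2 * h) + 7
  double = solve-∀
  halve : ∀ h → 1 + 2 * h + 7 ≡ (4 + h) * 2
  halve = solve-∀

open ℤ using (ℤ; +_)

+-shift : ∀ {x} y d → x ≡ y + d → + x ≡ + y ℤ.+ + d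
+-shift y d x≡y+d = trans (cong +_ x≡y+d) (pos-+ y d)

opaque
  unfolding formula
  twiceFormula-unfold : ∀ g → twiceFormula g ≡
    formula (+ g) (+ (2 * g)) (+ (g / 4)) (+ (g / 2)) (+ ((g + 5) / 6))
            (+ ((g + 2) / 6)) (+ ((g + 2) / 4)) (+ ((g + 1) / 2)) (+ ceil8 (2 * g ∸ 3)) (+ ceil8 (2 * g ∸ 7))
  twiceFormula-unfold g = refl

module Atoms (g : ℕ) where
  A = + (g / 4)
  B = + (g / 2)
  C = + ((g + 5) / 6)
  D = + ((g + 2) / 6)
  E = + ((g + 2) / 4)
  F = + ((g + 1) / 2)

  g≡B+F : + g ≡ B ℤ.+ F
  g≡B+F = +-shift (g / 2) ((g + 1) / 2) (sym (n/2+[n+1]/2≡n g))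

  twiceFormula≡formula : 4 ≤ g → twiceFormula g ≡ formula (B ℤ.+ F) (+ (2 * g)) A B C D E F E A
  twiceFormula≡formula 4≤g = begin
    twiceFormula g
      ≡⟨ twiceFormula-unfold g ⟩
    formula (+ g) (+ (2 * g)) A B C D E F (+ ceil8 (2 * g ∸ 3)) (+ ceil8 (2 * g ∸ 7))
      ≡⟨ formula-cong g≡B+F refl refl refl refl refl refl refl
           (cong +_ (ceil8[2n∸3]≡[n+2]/4 g (≤-trans (s≤s (s≤s z≤n)) 4≤g)))
           (cong +_ (ceil8[2n∸7]≡n/4 g 4≤g)) ⟩
    formula (B ℤ.+ F) (+ (2 * g)) A B C D E F E A ∎
    where open ≡-Reasoning

twiceFormula-step : ∀ g → 4 ≤ g → twiceFormula (12 + g) ≡ twiceFormula g ℤ.+ (+ 4 ℤ.* + g ℤ.+ + 36)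
twiceFormula-step g 4≤g = begin
  twiceFormula (12 + g)
    ≡⟨ twiceFormula≡formula′ (≤-trans 4≤g (m≤n+m g 12)) ⟩
  formula (B′ ℤ.+ F′) (+ (2 * (12 + g))) A′ B′ C′ D′ E′ F′ E′ A′
    ≡⟨ formula-cong (cong₂ ℤ._+_ shiftB shiftF) (+-shift (2 * g) 24 (double g))
         shiftA shiftB shiftC shiftD shiftE shiftF shiftE shiftA ⟩
  formula (B ℤ.+ + 6 ℤ.+ (F ℤ.+ + 6)) (+ (2 * g) ℤ.+ + 24) (A ℤ.+ + 3) (B ℤ.+ + 6)
    (C ℤ.+ + 2) (D ℤ.+ + 2) (E ℤ.+ + 3) (F ℤ.+ + 6) (E ℤ.+ + 3) (A ℤ.+ + 3)
    ≡⟨ formula-shift (+ (2 * g)) A B C D E F ⟩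
  formula (B ℤ.+ F) (+ (2 * g)) A B C D E F E A ℤ.+ (+ 4 ℤ.* (B ℤ.+ F) ℤ.+ + 36)
    ≡⟨ cong₂ (λ x y → x ℤ.+ (+ 4 ℤ.* y ℤ.+ + 36)) (sym (twiceFormula≡formula 4≤g)) (sym g≡B+F) ⟩
  twiceFormula g ℤ.+ (+ 4 ℤ.* + g ℤ.+ + 36) ∎
  where
  open ≡-Reasoning
  open Atoms g
  open Atoms (12 + g) using ()
    renaming (A to A′; B to B′; C to C′; D to D′; E to E′; F to F′; twiceFormula≡formula to twiceFormula≡formula′)
  shiftA = +-shift _ 3 ([kn+m]/n≡m/n+k 3 4 g)
  shiftB = +-shift _ 6 ([kn+m]/n≡m/n+k 6 2 g)
  shiftC = +-shift _ 2 ([kn+m]/n≡m/n+k 2 6 (g + 5))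
  shiftD = +-shift _ 2 ([kn+m]/n≡m/n+k 2 6 (g + 2))
  shiftE = +-shift _ 3 ([kn+m]/n≡m/n+k 3 4 (g + 2))
  shiftF = +-shift _ 6 ([kn+m]/n≡m/n+k 6 2 (g + 1))
  double : ∀ g → 2 * (12 + g) ≡ 2 * g + 24
  double = solve-∀

twiceSliceSum-step : ∀ g → + (2 * sliceSum (12 + g)) ≡ + (2 * sliceSum g) ℤ.+ (+ 4 ℤ.* + g ℤ.+ + 36)
twiceSliceSum-step g = begin
  + (2 * sliceSum (12 + g))                  ≡⟨ cong (λ s → + (2 * s)) (sliceSum-step12 g) ⟩
  + (2 * (sliceSum g + (18 + 2 * g)))        ≡⟨ cong +_ (distrib (sliceSum g) g) ⟩
  + (2 * sliceSum g + (4 * g + 36))          ≡⟨ pos-+ (2 * sliceSum g) (4 * g + 36) ⟩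
  + (2 * sliceSum g) ℤ.+ + (4 * g + 36)      ≡⟨ cong (λ x → + (2 * sliceSum g) ℤ.+ (x ℤ.+ + 36)) (pos-* 4 g) ⟩
  + (2 * sliceSum g) ℤ.+ (+ 4 ℤ.* + g ℤ.+ + 36) ∎
  where
  open ≡-Reasoning
  distrib : ∀ s g → 2 * (s + (18 + 2 * g)) ≡ 2 * s + (4 * g + 36)
  distrib = solve-∀

twiceSliceSum≡twiceFormula : ∀ n → + (2 * sliceSum (4 + n)) ≡ twiceFormula (4 + n)
twiceSliceSum≡twiceFormula 0  = refl
twiceSliceSum≡twiceFormula 1  = refl
twiceSliceSum≡twiceFormula 2  = refl
twiceSliceSum≡twiceFormula 3  = refl
twiceSliceSum≡twiceFormula 4  = refl
twiceSliceSum≡twiceFormula 5  = refl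
twiceSliceSum≡twiceFormula 6  = refl
twiceSliceSum≡twiceFormula 7  = refl
twiceSliceSum≡twiceFormula 8  = refl
twiceSliceSum≡twiceFormula 9  = refl
twiceSliceSum≡twiceFormula 10 = refl
twiceSliceSum≡twiceFormula 11 = refl
twiceSliceSum≡twiceFormula (suc (suc (suc (suc (suc (suc (suc (suc (suc (suc (suc (suc n)))))))))))) = begin
  + (2 * sliceSum (12 + (4 + n)))     ≡⟨ twiceSliceSum-step (4 + n) ⟩
  + (2 * sliceSum (4 + n)) ℤ.+ step    ≡⟨ cong (ℤ._+ step) (twiceSliceSum≡twiceFormula n) ⟩
  twiceFormula (4 + n) ℤ.+ step        ≡⟨ twiceFormula-step (4 + n) (m≤m+n 4 n) ⟨
  twiceFormula (12 + (4 + n))          ∎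
  where
  open ≡-Reasoning
  step = + 4 ℤ.* + (4 + n) ℤ.+ + 36

mainTheorem8 : (g : ℕ) → 3 ≤ g →
    (g ≡ 3 → HasCardinality (InS4g g) 1) ×
    (4 ≤ g → ∃[ N ] (HasCardinality (InS4g g) N × + (2 * N) ≡ twiceFormula g))
mainTheorem8 g _ = (λ { refl → semigroups4-cardinality 3 }) , λ 4≤g →
  length (semigroups4 g) , semigroups4-cardinality g , (begin
    + (2 * length (semigroups4 g))  ≡⟨ cong (λ N → + (2 * N)) (length-semigroups4 4≤g) ⟩
    + (2 * sliceSum g)              ≡⟨ twiceFormula-from4 4≤g ⟩
    twiceFormula g                  ∎)
  where
  open ≡-Reasoning
  twiceFormula-from4 : ∀ {g} → 4 ≤ g → + (2 * sliceSum g) ≡ twiceFormula g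
  twiceFormula-from4 (s≤s (s≤s (s≤s (s≤s (z≤n {n}))))) = twiceSliceSum≡twiceFormula n
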